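{- Let $K(v)$ be a complete multipartite graph and $E$ a set of edges of $K(v)$. If the graph $\langle E\rangle$ contains a triangle, then the number of garlands does not exceed $5\cdot 2^{|E|-3} - 1$.
   Context: All graphs are finite and simple. For a sequence $v=(v_1,\dots,v_t)$ of positive integers, $K(v)$ is the complete $t$-partite graph with parts $V_1,\dots,V_t$, $|V_i|=v_i$. $\langle E\rangle$ is the subgraph of $K(v)$ consisting of the edges of $E$ and their endpoints. An $E$-subgraph is a subgraph $G_1$ of $K(v)$ which is a complete multipartite graph (with at least two nonempty parts) such that every part of $G_1$ is contained in some part of $K(v)$ and every edge of $G_1$ belongs to $E$. A garland is a nonempty set of pairwise vertex-disjoint $E$-subgraphs. -}

module Defs where

open import Data.Nat using (ℕ; _≤_; _+_; _*_; _∸_; _^_)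
open import Data.Fin using (Fin; toℕ)
open import Data.Bool using (Bool; true)
open import Data.Vec using (Vec; lookup)
open import Data.List using (List; []; length)
open import Data.List.Membership.Propositional using (_∈_)
open import Data.List.Relation.Unary.Unique.Propositional using (Unique)
open import Data.List.Relation.Unary.AllPairs using (AllPairs)
open import Data.Product using (Σ; ∃; _×_; _,_)
open import Data.Sum using (_⊎_)
open import Relation.Binary.PropositionalEquality using (_≡_; _≢_)
open import Relation.Nullary using (¬_)
open import Function.Bundles using (_⇔_)

-- The complete multipartite graph K(v): vertex set Fin n, and the part
-- of vertex x is  p x : Fin t  (V_i = p⁻¹(i)).  All parts nonempty (v_i > 0)
-- is the condition that p is surjective.
Surjective : ∀ {n t} → (Fin n → Fin t) → Set
Surjective {n} {t} p = ∀ (i : Fin t) → ∃ λ (x : Fin n) → p x ≡ i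

-- An edge {x,y} of K(v) is stored as the ordered pair (x , y) with x < y.
IsKEdge : ∀ {n t} → (Fin n → Fin t) → Fin n × Fin n → Set
IsKEdge p (x , y) = (toℕ x Data.Nat.< toℕ y) × (p x ≢ p y)

IsEdgeSet : ∀ {n t} → (Fin n → Fin t) → List (Fin n × Fin n) → Set
IsEdgeSet p E = Unique E × (∀ {e} → e ∈ E → IsKEdge p e)

AdjE : ∀ {n} → List (Fin n × Fin n) → Fin n → Fin n → Set
AdjE E x y = ((x , y) ∈ E) ⊎ ((y , x) ∈ E)

HasTriangle : ∀ {n} → List (Fin n × Fin n) → Set
HasTriangle {n} E = Σ (Fin n) λ a → Σ (Fin n) λ b → Σ (Fin n) λ c →
  AdjE E a b × AdjE E b c × AdjE E a c

-- A subgraph of K(v): a vertex set W (a Bool-vector) and an edge set F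
-- (a Bool adjacency matrix; F[x][y] = true means {x,y} is an edge).
Subgraph : ℕ → Set
Subgraph n = Vec Bool n × Vec (Vec Bool n) n

InW : ∀ {n} → Vec Bool n → Fin n → Set
InW W x = lookup W x ≡ true

EdgeF : ∀ {n} → Vec (Vec Bool n) n → Fin n → Fin n → Set
EdgeF F x y = lookup (lookup F x) y ≡ true

IsSubgraphK : ∀ {n t} → (Fin n → Fin t) → Subgraph n → Set
IsSubgraphK p (W , F) = ∀ x y → EdgeF F x y → InW W x × InW W y × (p x ≢ p y)

IsCMPinK : ∀ {n t} → (Fin n → Fin t) → Subgraph n → Set
IsCMPinK {n} {t} p (W , F) = Σ ℕ λ s → (2 ≤ s) × Σ (Fin n → Fin s) λ c →
    (∀ (j : Fin s) → ∃ λ x → InW W x × c x ≡ j)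
  × (∀ x y → EdgeF F x y ⇔ (InW W x × InW W y × c x ≢ c y))
  × (∀ (j : Fin s) → ∃ λ (i : Fin t) → ∀ x → InW W x → c x ≡ j → p x ≡ i)

IsESubgraph : ∀ {n t} → (Fin n → Fin t) → List (Fin n × Fin n) → Subgraph n → Set
IsESubgraph p E G@(W , F) =
  IsSubgraphK p G × IsCMPinK p G × (∀ x y → EdgeF F x y → AdjE E x y)

VertexDisjoint : ∀ {n} → Subgraph n → Subgraph n → Set
VertexDisjoint (W , _) (W' , _) = ∀ x → ¬ (InW W x × InW W' x)

-- A garland, a finite set of E-subgraphs, represented by a list
-- (sets = lists up to having the same members).
IsGarland : ∀ {n t} → (Fin n → Fin t) → List (Fin n × Fin n) → List (Subgraph n) → Set
IsGarland p E g =
    (g ≢ [])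
  × (∀ {G} → G ∈ g → IsESubgraph p E G)
  × (∀ {G H} → G ∈ g → H ∈ g → G ≢ H → VertexDisjoint G H)

SameSet : ∀ {A : Set} → List A → List A → Set
SameSet g h = ∀ G → (G ∈ g) ⇔ (G ∈ h)

-- "the number of garlands is at most N": every list of pairwise distinct
-- garlands (as sets) has length at most N.
NumGarlandsAtMost : ∀ {n t} → (Fin n → Fin t) → List (Fin n × Fin n) → ℕ → Set
NumGarlandsAtMost {n} p E N =
  ∀ (L : List (List (Subgraph n))) →
    (∀ {g} → g ∈ L → IsGarland p E g) →
    AllPairs (λ g h → ¬ SameSet g h) L →
    length L ≤ N

module Submission where

-- Garlands are counted by encoding each one as a Boolean word, one letter per
-- edge of E.  The union graph of a garland g (all edges of all its members)
-- is a subgraph of ⟨E⟩, so it is recorded by the word saying which edges of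
-- E it contains.  Three facts make the count work.
--   * The union graph determines the garland: a member is the E-subgraph of
--     the garland containing any one of its edges, and the other members are
--     vertex disjoint from it.  So the code is injective on garlands.
--   * Inside one member, two edges xy, yz with x, z in different parts of
--     K(v) force the edge xz.  Hence on a triangle abc of ⟨E⟩ the three
--     letters never consist of exactly two trues: only 5 of the 8 patterns.
--   * A garland is nonempty, so its code is not the all-false word.
-- Listing the triangle edges first, codes lie among 5·2^(|E|−3) − 1 words.

open import Defs
open import Data.Nat using (ℕ; zero; suc; _+_; _*_; _∸_; _^_; _≤_; _<_; z≤n; s≤s)
open import Data.Nat.Properties
  using (≤-trans; +-comm; +-identityʳ; m+n≤o⇒m≤o∸n; ^-monoʳ-≤; *-monoʳ-≤; ∸-monoˡ-≤; module ≤-Reasoning)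
open import Data.Bool using (Bool; true; false; T; T?)
import Data.Bool as Bool
open import Data.Fin using (Fin; zero; suc)
import Data.Fin as Fin
open import Data.Vec using (Vec; lookup)
open import Data.Vec.Properties using (tabulate∘lookup; tabulate-cong)
import Data.Vec.Properties as Vec
import Data.Product.Properties as Product
open import Data.List
  using (List; []; _∷_; [_]; length; map; filter; _++_; replicate; cartesianProductWith)
open import Data.List.Properties using (length-map; length-++; filter-notAll; ∷-injectiveˡ; ∷-injectiveʳ)
import Data.List.Properties as List
open import Data.List.Membership.Propositional using (_∈_; find; lose)
open import Data.List.Membership.Propositional.Properties
  using (∈-map⁺; ∈-++⁺ˡ; ∈-++⁺ʳ; ∈-filter⁺; ∈-cartesianProductWith⁺)
open import Data.List.Relation.Unary.Any as Any using (Any; here; there)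
open import Data.List.Relation.Unary.Any.Properties using (map⁺)
open import Data.List.Relation.Unary.All as All using (All)
open import Data.List.Relation.Unary.AllPairs using (AllPairs; []; _∷_)
open import Data.Product using (Σ; _×_; _,_; proj₁; proj₂)
open import Data.Sum using (_⊎_; inj₁; inj₂)
open import Data.Empty using (⊥-elim)
open import Function using (_∘_)
open import Function.Bundles using (_⇔_; mk⇔; Equivalence)
open import Relation.Binary.Definitions using (DecidableEquality)
open import Relation.Binary.PropositionalEquality
  using (_≡_; _≢_; refl; sym; trans; cong; cong₂; subst; module ≡-Reasoning)
open import Relation.Nullary using (¬_; Dec; yes; no; ¬?; does)

length-≤-by-injection : ∀ {A B : Set} {R : A → A → Set} → DecidableEquality B →
  (f : A → B) (xs : List A) (ys : List B) → AllPairs R xs →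
  (∀ {a b} → a ∈ xs → b ∈ xs → R a b → f a ≢ f b) →
  (∀ {a} → a ∈ xs → f a ∈ ys) → length xs ≤ length ys
length-≤-by-injection _≟_ f [] ys _ _ _ = z≤n
length-≤-by-injection {B = B} {R} _≟_ f (x ∷ xs) ys (Rx ∷ pairs) separates into =
  ≤-trans (s≤s rest-fits) (filter-notAll differs? ys (Any.map (λ eq neq → neq (sym eq)) (into (here refl))))
  where
  differs? : (y : B) → Dec (¬ (y ≡ f x))
  differs? y = ¬? (y ≟ f x)
  -- the images of the other entries avoid f x, so they land in ys minus f x
  rest-fits : length xs ≤ length (filter differs? ys)
  rest-fits = length-≤-by-injection _≟_ f xs (filter differs? ys) pairs
    (λ a b r → separates (there a) (there b) r)
    (λ m → ∈-filter⁺ differs? (into (there m))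
      (λ eq → separates (here refl) (there m) (All.lookup Rx m) (sym eq)))

length-cartesianProductWith : ∀ {A B C : Set} (f : A → B → C) (xs : List A) (ys : List B) →
  length (cartesianProductWith f xs ys) ≡ length xs * length ys
length-cartesianProductWith f [] ys = refl
length-cartesianProductWith f (x ∷ xs) ys = begin
  length (map (f x) ys ++ cartesianProductWith f xs ys)
    ≡⟨ length-++ (map (f x) ys) ⟩
  length (map (f x) ys) + length (cartesianProductWith f xs ys)
    ≡⟨ cong₂ _+_ (length-map (f x) ys) (length-cartesianProductWith f xs ys) ⟩
  length ys + length xs * length ys ∎
  where open ≡-Reasoning

map-≡-at : ∀ {A B : Set} {f f′ : A → B} {x} (xs : List A) → map f xs ≡ map f′ xs → x ∈ xs → f x ≡ f′ x
map-≡-at (_ ∷ xs) same (here refl) = ∷-injectiveˡ same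
map-≡-at (_ ∷ xs) same (there x∈xs) = map-≡-at xs (∷-injectiveʳ same) x∈xs

module Without {A : Set} (_≟_ : DecidableEquality A) where

  without : A → List A → List A
  without e = filter (λ x → ¬? (x ≟ e))

  length-without : ∀ {e xs} → e ∈ xs → length (without e xs) < length xs
  length-without {e} {xs} e∈xs = filter-notAll (λ x → ¬? (x ≟ e)) xs (Any.map (λ eq neq → neq (sym eq)) e∈xs)

  ∈-without : ∀ {e x xs} → x ∈ xs → x ≢ e → x ∈ without e xs
  ∈-without {e} x∈xs x≢e = ∈-filter⁺ (λ x → ¬? (x ≟ e)) x∈xs x≢e

  moveThreeToFront : ∀ {e₁ e₂ e₃ xs} → e₁ ∈ xs → e₂ ∈ xs → e₃ ∈ xs →
    e₂ ≢ e₁ → e₃ ≢ e₁ → e₃ ≢ e₂ →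
    Σ (List A) λ rest → length rest ≤ length xs ∸ 3 × (∀ {x} → x ∈ xs → x ∈ e₁ ∷ e₂ ∷ e₃ ∷ rest)
  moveThreeToFront {e₁} {e₂} {e₃} {xs} e₁∈ e₂∈ e₃∈ e₂≢e₁ e₃≢e₁ e₃≢e₂ =
    rest , m+n≤o⇒m≤o∸n (length rest) (subst (_≤ length xs) (+-comm 3 (length rest)) shorter) , covers
    where
    xs₁ xs₂ rest : List A
    xs₁ = without e₁ xs
    xs₂ = without e₂ xs₁
    rest = without e₃ xs₂
    e₂∈xs₁ : e₂ ∈ xs₁
    e₂∈xs₁ = ∈-without e₂∈ e₂≢e₁
    e₃∈xs₂ : e₃ ∈ xs₂
    e₃∈xs₂ = ∈-without (∈-without e₃∈ e₃≢e₁) e₃≢e₂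
    shorter : 3 + length rest ≤ length xs
    shorter = ≤-trans (s≤s (s≤s (length-without e₃∈xs₂)))
                (≤-trans (s≤s (length-without e₂∈xs₁)) (length-without e₁∈))
    covers : ∀ {x} → x ∈ xs → x ∈ e₁ ∷ e₂ ∷ e₃ ∷ rest
    covers {x} x∈ with x ≟ e₁ | x ≟ e₂ | x ≟ e₃
    ... | yes refl | _        | _        = here refl
    ... | no _     | yes refl | _        = there (here refl)
    ... | no _     | no _     | yes refl = there (there (here refl))
    ... | no x≢e₁  | no x≢e₂  | no x≢e₃  =
      there (there (there (∈-without (∈-without (∈-without x∈ x≢e₁) x≢e₂) x≢e₃)))

words : ℕ → List (List Bool)
words zero = [ [] ]
words (suc k) = map (true ∷_) (words k) ++ map (false ∷_) (words k)

length-words : ∀ k → length (words k) ≡ 2 ^ k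
length-words zero = refl
length-words (suc k) = begin
  length (map (true ∷_) ws ++ map (false ∷_) ws)   ≡⟨ length-++ (map (true ∷_) ws) ⟩
  length (map (true ∷_) ws) + length (map (false ∷_) ws)
    ≡⟨ cong₂ _+_ (length-map (true ∷_) ws) (length-map (false ∷_) ws) ⟩
  length ws + length ws                             ≡⟨ cong (λ m → m + m) (length-words k) ⟩
  2 ^ k + 2 ^ k                                     ≡⟨ cong (2 ^ k +_) (sym (+-identityʳ (2 ^ k))) ⟩
  2 ^ suc k                                         ∎
  where
  open ≡-Reasoning
  ws : List (List Bool)
  ws = words k

∈-words : ∀ (w : List Bool) → w ∈ words (length w)
∈-words [] = here refl
∈-words (true ∷ w) = ∈-++⁺ˡ (∈-map⁺ (true ∷_) (∈-words w))
∈-words (false ∷ w) = ∈-++⁺ʳ _ (∈-map⁺ (false ∷_) (∈-words w))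

Closed : Bool → Bool → Bool → Set
Closed b₁ b₂ b₃ = (T b₁ → T b₂ → T b₃) × (T b₁ → T b₃ → T b₂) × (T b₂ → T b₃ → T b₁)

closedTriples : List (List Bool)
closedTriples =
  (false ∷ false ∷ false ∷ []) ∷ (true ∷ false ∷ false ∷ []) ∷ (false ∷ true ∷ false ∷ []) ∷
  (false ∷ false ∷ true ∷ []) ∷ (true ∷ true ∷ true ∷ []) ∷ []

∈-closedTriples : ∀ b₁ b₂ b₃ → Closed b₁ b₂ b₃ → (b₁ ∷ b₂ ∷ b₃ ∷ []) ∈ closedTriples
∈-closedTriples false false false _ = here refl
∈-closedTriples true  false false _ = there (here refl)
∈-closedTriples false true  false _ = there (there (here refl))
∈-closedTriples false false true  _ = there (there (there (here refl)))
∈-closedTriples true  true  true  _ = there (there (there (there (here refl))))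
∈-closedTriples true  true  false (c , _) = ⊥-elim (c _ _)
∈-closedTriples true  false true  (_ , c , _) = ⊥-elim (c _ _)
∈-closedTriples false true  true  (_ , _ , c) = ⊥-elim (c _ _)

Nonzero : List Bool → Set
Nonzero = Any T

admissible : ℕ → List (List Bool)
admissible k = filter (Any.any? T?) (cartesianProductWith _++_ closedTriples (words k))

∈-admissible : ∀ b₁ b₂ b₃ (r : List Bool) → Closed b₁ b₂ b₃ → Nonzero (b₁ ∷ b₂ ∷ b₃ ∷ r) →
  (b₁ ∷ b₂ ∷ b₃ ∷ r) ∈ admissible (length r)
∈-admissible b₁ b₂ b₃ r closed nonzero =
  ∈-filter⁺ (Any.any? T?) (∈-cartesianProductWith⁺ _++_ (∈-closedTriples b₁ b₂ b₃ closed) (∈-words r)) nonzero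

-- There are 5·2^k closed words, one of which (all false) is excluded.
length-admissible : ∀ k → length (admissible k) ≤ 5 * 2 ^ k ∸ 1
length-admissible k = <⇒≤∸1 (subst (length (admissible k) <_) count
  (filter-notAll (Any.any? T?) closedWords (lose zero∈ (zero-not-nonzero (3 + k)))))
  where
  closedWords : List (List Bool)
  closedWords = cartesianProductWith _++_ closedTriples (words k)
  count : length closedWords ≡ 5 * 2 ^ k
  count = trans (length-cartesianProductWith _++_ closedTriples (words k)) (cong (5 *_) (length-words k))
  zero∈ : (false ∷ false ∷ false ∷ replicate k false) ∈ closedWords
  zero∈ = ∈-cartesianProductWith⁺ _++_ {xs = closedTriples} (here refl)
    (subst (λ m → replicate k false ∈ words m) (List.length-replicate k) (∈-words (replicate k false)))
  zero-not-nonzero : ∀ m → ¬ Nonzero (replicate m false)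
  zero-not-nonzero (suc m) (there z) = zero-not-nonzero m z
  <⇒≤∸1 : ∀ {a b} → a < b → a ≤ b ∸ 1
  <⇒≤∸1 (s≤s a≤b) = a≤b

module ESubgraph {n t : ℕ} (p : Fin n → Fin t) (E : List (Fin n × Fin n))
                 {W : Vec Bool n} {F : Vec (Vec Bool n) n} (es : IsESubgraph p E (W , F)) where

  private
    cmp : IsCMPinK p (W , F)
    cmp = proj₁ (proj₂ es)
    s : ℕ
    s = proj₁ cmp
    two≤s : 2 ≤ s
    two≤s = proj₁ (proj₂ cmp)
    c : Fin n → Fin s
    c = proj₁ (proj₂ (proj₂ cmp))
    parts-nonempty : ∀ j → Σ (Fin n) λ x → InW W x × c x ≡ j
    parts-nonempty = proj₁ (proj₂ (proj₂ (proj₂ cmp)))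
    edges-are : ∀ x y → EdgeF F x y ⇔ (InW W x × InW W y × c x ≢ c y)
    edges-are = proj₁ (proj₂ (proj₂ (proj₂ (proj₂ cmp))))
    parts-inside : ∀ j → Σ (Fin t) λ i → ∀ x → InW W x → c x ≡ j → p x ≡ i
    parts-inside = proj₂ (proj₂ (proj₂ (proj₂ (proj₂ cmp))))

  in-E : ∀ x y → EdgeF F x y → AdjE E x y
  in-E = proj₂ (proj₂ es)

  endpoint₁ : ∀ {x y} → EdgeF F x y → InW W x
  endpoint₁ {x} {y} e = proj₁ (proj₁ es x y e)

  endpoint₂ : ∀ {x y} → EdgeF F x y → InW W y
  endpoint₂ {x} {y} e = proj₁ (proj₂ (proj₁ es x y e))

  edge : ∀ {x y} → InW W x → InW W y → c x ≢ c y → EdgeF F x y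
  edge {x} {y} wx wy d = Equivalence.from (edges-are x y) (wx , wy , d)

  edge-labels : ∀ {x y} → EdgeF F x y → c x ≢ c y
  edge-labels {x} {y} e = proj₂ (proj₂ (Equivalence.to (edges-are x y) e))

  edge-sym : ∀ {x y} → EdgeF F x y → EdgeF F y x
  edge-sym e = edge (endpoint₂ e) (endpoint₁ e) (edge-labels e ∘ sym)

  -- Each part of the subgraph lies inside one part of K(v), so vertices in
  -- different parts of K(v) have different labels: the edge relation is
  -- closed under xy, yz ↦ xz when p x ≢ p z.
  edge-close : ∀ {x y z} → EdgeF F x y → EdgeF F y z → p x ≢ p z → EdgeF F x z
  edge-close {x} {z = z} exy eyz px≢pz = edge (endpoint₁ exy) (endpoint₂ eyz) λ cx≡cz →
    let (i , inside) = parts-inside (c x) in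
    px≢pz (trans (inside x (endpoint₁ exy) refl) (sym (inside z (endpoint₂ eyz) (sym cx≡cz))))

  edge-nearby : ∀ {x y u} → EdgeF F x y → InW W u → EdgeF F u x ⊎ EdgeF F u y
  edge-nearby {x} {y} {u} exy wu with c u Fin.≟ c x
  ... | no cu≢cx = inj₁ (edge wu (endpoint₁ exy) cu≢cx)
  ... | yes cu≡cx = inj₂ (edge wu (endpoint₂ exy) (λ cu≡cy → edge-labels exy (trans (sym cu≡cx) cu≡cy)))

  private
    two-labels : Σ (Fin s) λ j₀ → Σ (Fin s) λ j₁ → j₀ ≢ j₁
    two-labels with s | two≤s
    ... | suc (suc _) | s≤s (s≤s _) = zero , suc zero , λ ()

  some-edge : Σ (Fin n) λ x → Σ (Fin n) λ y → EdgeF F x y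
  some-edge with two-labels
  ... | j₀ , j₁ , j₀≢j₁ with parts-nonempty j₀ | parts-nonempty j₁
  ... | x , wx , cx | y , wy , cy = x , y , edge wx wy (λ cx≡cy → j₀≢j₁ (trans (sym cx) (trans cx≡cy cy)))

  incident-edge : ∀ {x} → InW W x → Σ (Fin n) λ y → EdgeF F x y
  incident-edge {x} wx with two-labels
  ... | j₀ , j₁ , j₀≢j₁ with parts-nonempty j₀ | parts-nonempty j₁ | c x Fin.≟ j₀
  ... | _ | y₁ , w₁ , c₁ | yes cx≡j₀ = y₁ , edge wx w₁ (λ cx≡cy → j₀≢j₁ (trans (sym cx≡j₀) (trans cx≡cy c₁)))
  ... | y₀ , w₀ , c₀ | _ | no cx≢j₀ = y₀ , edge wx w₀ (λ cx≡cy → cx≢j₀ (trans cx≡cy c₀))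

module _ {n : ℕ} where

  record Linked (g : List (Subgraph n)) (x y : Fin n) : Set where
    constructor mkLinked
    field witness : Any (λ G → EdgeF (proj₂ G) x y) g

  linked? : ∀ g x y → Dec (Linked g x y)
  linked? g x y with Any.any? (λ G → lookup (lookup (proj₂ G) x) y Bool.≟ true) g
  ... | yes w = yes (mkLinked w)
  ... | no ¬w = no (λ l → ¬w (Linked.witness l))

  linked : ∀ {g G x y} → G ∈ g → EdgeF (proj₂ G) x y → Linked g x y
  linked {x = x} {y} G∈g e = mkLinked (lose {P = λ G → EdgeF (proj₂ G) x y} G∈g e)

  owner : ∀ {g x y} → Linked g x y → Σ (Subgraph n) λ G → G ∈ g × EdgeF (proj₂ G) x y
  owner l = find (Linked.witness l)

  edgeBit : List (Subgraph n) → Fin n × Fin n → Bool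
  edgeBit g e = does (linked? g (proj₁ e) (proj₂ e))

  linked⇒edgeBit : ∀ {g x y} → Linked g x y → T (edgeBit g (x , y))
  linked⇒edgeBit {g} {x} {y} l with linked? g x y
  ... | yes _ = _
  ... | no ¬l = ¬l l

  edgeBit⇒linked : ∀ {g x y} → T (edgeBit g (x , y)) → Linked g x y
  edgeBit⇒linked {g} {x} {y} b with linked? g x y
  ... | yes l = l

  Joins : Fin n × Fin n → Fin n → Fin n → Set
  Joins e x y = e ≡ (x , y) ⊎ e ≡ (y , x)

  stored : ∀ {E x y} → AdjE E x y → Σ (Fin n × Fin n) λ e → e ∈ E × Joins e x y
  stored (inj₁ xy∈E) = _ , xy∈E , inj₁ refl
  stored (inj₂ yx∈E) = _ , yx∈E , inj₂ refl

  joins-same : ∀ {e x y u v} → Joins e x y → Joins e u v → (x ≡ u × y ≡ v) ⊎ (x ≡ v × y ≡ u)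
  joins-same (inj₁ refl) (inj₁ eq) = inj₁ (cong proj₁ eq , cong proj₂ eq)
  joins-same (inj₁ refl) (inj₂ eq) = inj₂ (cong proj₁ eq , cong proj₂ eq)
  joins-same (inj₂ refl) (inj₁ eq) = inj₂ (cong proj₂ eq , cong proj₁ eq)
  joins-same (inj₂ refl) (inj₂ eq) = inj₁ (cong proj₂ eq , cong proj₁ eq)

  joins-differ : ∀ {e e′ : Fin n × Fin n} {x y u v : Fin n} → Joins e x y → Joins e′ u v →
    ¬ ((x ≡ u × y ≡ v) ⊎ (x ≡ v × y ≡ u)) → e ≢ e′
  joins-differ j j′ different refl = different (joins-same j j′)

  -- Vertex disjointness speaks about distinct members, so equality is decided.
  _≟Sub_ : DecidableEquality (Subgraph n)
  _≟Sub_ = Product.≡-dec (Vec.≡-dec Bool._≟_) (Vec.≡-dec (Vec.≡-dec Bool._≟_))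

-- For a garland, the union graph inherits symmetry and the closure property
-- of its members, because every vertex belongs to at most one member.
module Garland {n t : ℕ} (p : Fin n → Fin t) (E : List (Fin n × Fin n))
               {g : List (Subgraph n)} (gar : IsGarland p E g) where

  member : ∀ {G} → G ∈ g → IsESubgraph p E G
  member = proj₁ (proj₂ gar)

  module Member {G} (G∈g : G ∈ g) = ESubgraph p E {proj₁ G} {proj₂ G} (member G∈g)

  same-member : ∀ {G H} x → G ∈ g → H ∈ g → InW (proj₁ G) x → InW (proj₁ H) x → G ≡ H
  same-member {G} {H} x G∈g H∈g xG xH with G ≟Sub H
  ... | yes G≡H = G≡H
  ... | no G≢H = ⊥-elim (proj₂ (proj₂ gar) G∈g H∈g G≢H x (xG , xH))

  edge-of-member : ∀ {H u v} → H ∈ g → InW (proj₁ H) u → Linked g u v → EdgeF (proj₂ H) u v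
  edge-of-member {u = u} H∈g uH l with owner l
  ... | H′ , H′∈g , e with same-member u H′∈g H∈g (Member.endpoint₁ H′∈g e) uH
  ... | refl = e

  linked-sym : ∀ {x y} → Linked g x y → Linked g y x
  linked-sym l with owner l
  ... | G , G∈g , e = linked G∈g (Member.edge-sym G∈g e)

  linked-close : ∀ {x y z} → Linked g x y → Linked g y z → p x ≢ p z → Linked g x z
  linked-close lxy lyz px≢pz with owner lxy
  ... | G , G∈g , exy =
    linked G∈g (Member.edge-close G∈g exy (edge-of-member G∈g (Member.endpoint₂ G∈g exy) lyz) px≢pz)

  linked-in-E : ∀ {x y} → Linked g x y → AdjE E x y
  linked-in-E {x} {y} l with owner l
  ... | G , G∈g , e = Member.in-E G∈g x y e

  joins⇒edgeBit : ∀ {e x y} → Joins e x y → Linked g x y → T (edgeBit g e)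
  joins⇒edgeBit (inj₁ refl) l = linked⇒edgeBit l
  joins⇒edgeBit (inj₂ refl) l = linked⇒edgeBit (linked-sym l)

  edgeBit⇒joins : ∀ {e x y} → Joins e x y → T (edgeBit g e) → Linked g x y
  edgeBit⇒joins (inj₁ refl) b = edgeBit⇒linked b
  edgeBit⇒joins (inj₂ refl) b = linked-sym (edgeBit⇒linked b)

  triangle-closed : ∀ {a b c e₁ e₂ e₃} → Joins e₁ a b → Joins e₂ b c → Joins e₃ a c →
    p a ≢ p b → p b ≢ p c → p a ≢ p c → Closed (edgeBit g e₁) (edgeBit g e₂) (edgeBit g e₃)
  triangle-closed ab bc ac pa≢pb pb≢pc pa≢pc =
      (λ t₁ t₂ → joins⇒edgeBit ac (linked-close (edgeBit⇒joins ab t₁) (edgeBit⇒joins bc t₂) pa≢pc))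
    , (λ t₁ t₃ → joins⇒edgeBit bc (linked-close (linked-sym (edgeBit⇒joins ab t₁)) (edgeBit⇒joins ac t₃) pb≢pc))
    , (λ t₂ t₃ → joins⇒edgeBit ab (linked-close (edgeBit⇒joins ac t₃) (linked-sym (edgeBit⇒joins bc t₂)) pa≢pb))

module Reconstruction {n t : ℕ} (p : Fin n → Fin t) (E : List (Fin n × Fin n)) where

  private
    vec-ext : ∀ {A : Set} {m} (V V′ : Vec A m) → (∀ i → lookup V i ≡ lookup V′ i) → V ≡ V′
    vec-ext V V′ pointwise = trans (sym (tabulate∘lookup V)) (trans (tabulate-cong pointwise) (tabulate∘lookup V′))

    true-iff⇒≡ : ∀ {a b : Bool} → (a ≡ true → b ≡ true) → (b ≡ true → a ≡ true) → a ≡ b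
    true-iff⇒≡ {true} to _ = sym (to refl)
    true-iff⇒≡ {false} {true} _ from = from refl
    true-iff⇒≡ {false} {false} _ _ = refl

  module _ {g h : List (Subgraph n)} (gar-g : IsGarland p E g) (gar-h : IsGarland p E h)
           (g⊆h : ∀ {x y} → Linked g x y → Linked h x y) where

    -- If members G ∈ g and H ∈ h share an edge xy, every edge of G is an
    -- edge of H: its end u is adjacent in G to x or y, so u lies in H.
    edge-transfer : ∀ {G H x y u v} → G ∈ g → H ∈ h → EdgeF (proj₂ G) x y → EdgeF (proj₂ H) x y →
      EdgeF (proj₂ G) u v → EdgeF (proj₂ H) u v
    edge-transfer {G} {H} {u = u} G∈g H∈h Gxy Hxy Guv = Gh.edge-of-member H∈h u∈H (g⊆h (linked G∈g Guv))
      where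
      module Gg = Garland p E gar-g
      module Gh = Garland p E gar-h
      reach : ∀ {w} → InW (proj₁ H) w → EdgeF (proj₂ G) u w → InW (proj₁ H) u
      reach wH Guw = Gh.Member.endpoint₂ H∈h (Gh.edge-of-member H∈h wH (g⊆h (linked G∈g (Gg.Member.edge-sym G∈g Guw))))
      u∈H : InW (proj₁ H) u
      u∈H with Gg.Member.edge-nearby G∈g Gxy (Gg.Member.endpoint₁ G∈g Guv)
      ... | inj₁ Gux = reach (Gh.Member.endpoint₁ H∈h Hxy) Gux
      ... | inj₂ Guy = reach (Gh.Member.endpoint₂ H∈h Hxy) Guy

  -- With equal union graphs, members sharing an edge coincide: they have
  -- the same edges, and every vertex lies on an edge.
  same-member : ∀ {g h} (gar-g : IsGarland p E g) (gar-h : IsGarland p E h) →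
    (g⊆h : ∀ {x y} → Linked g x y → Linked h x y) → (h⊆g : ∀ {x y} → Linked h x y → Linked g x y) →
    ∀ {G H x y} → G ∈ g → H ∈ h → EdgeF (proj₂ G) x y → EdgeF (proj₂ H) x y → G ≡ H
  same-member gar-g gar-h g⊆h h⊆g {W , F} {W′ , F′} G∈g H∈h Gxy Hxy =
    cong₂ _,_ (vec-ext W W′ λ i → true-iff⇒≡ W→W′ W′→W)
              (vec-ext F F′ λ i → vec-ext (lookup F i) (lookup F′ i) λ j → true-iff⇒≡ G→H H→G)
    where
    module Gg = Garland p E gar-g
    module Gh = Garland p E gar-h
    G→H : ∀ {u v} → EdgeF F u v → EdgeF F′ u v
    G→H = edge-transfer gar-g gar-h g⊆h G∈g H∈h Gxy Hxy
    H→G : ∀ {u v} → EdgeF F′ u v → EdgeF F u v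
    H→G = edge-transfer gar-h gar-g h⊆g H∈h G∈g Hxy Gxy
    W→W′ : ∀ {i} → InW W i → InW W′ i
    W→W′ wi = Gh.Member.endpoint₁ H∈h (G→H (proj₂ (Gg.Member.incident-edge G∈g wi)))
    W′→W : ∀ {i} → InW W′ i → InW W i
    W′→W wi = Gg.Member.endpoint₁ G∈g (H→G (proj₂ (Gh.Member.incident-edge H∈h wi)))

  union-determines : ∀ {g h} → IsGarland p E g → IsGarland p E h →
    (∀ {x y} → Linked g x y → Linked h x y) → (∀ {x y} → Linked h x y → Linked g x y) → SameSet g h
  union-determines gar-g gar-h g⊆h h⊆g G = mk⇔ (transport gar-g gar-h g⊆h h⊆g) (transport gar-h gar-g h⊆g g⊆h)
    where
    -- G shares an edge with the member of the other garland owning that edge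
    transport : ∀ {g h} → IsGarland p E g → IsGarland p E h →
      (∀ {x y} → Linked g x y → Linked h x y) → (∀ {x y} → Linked h x y → Linked g x y) → G ∈ g → G ∈ h
    transport {h = h} gar-g gar-h g⊆h h⊆g G∈g with Garland.Member.some-edge p E gar-g G∈g
    ... | x , y , Gxy with owner (g⊆h (linked G∈g Gxy))
    ... | H , H∈h , Hxy = subst (_∈ h) (sym (same-member gar-g gar-h g⊆h h⊆g G∈g H∈h Gxy Hxy)) H∈h

-- Encoding garlands by words over a covering list of E whose first three
-- entries are the stored edges of a triangle abc of ⟨E⟩.
module Encoding {n t : ℕ} (p : Fin n → Fin t) (E : List (Fin n × Fin n))
                (in-K : ∀ {e} → e ∈ E → IsKEdge p e)
                {a b c : Fin n} (ab : AdjE E a b) (bc : AdjE E b c) (ac : AdjE E a c) where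

  private
    e₁ e₂ e₃ : Fin n × Fin n
    e₁ = proj₁ (stored ab)
    e₂ = proj₁ (stored bc)
    e₃ = proj₁ (stored ac)
    e₁∈E : e₁ ∈ E
    e₁∈E = proj₁ (proj₂ (stored ab))
    e₂∈E : e₂ ∈ E
    e₂∈E = proj₁ (proj₂ (stored bc))
    e₃∈E : e₃ ∈ E
    e₃∈E = proj₁ (proj₂ (stored ac))
    j₁ : Joins e₁ a b
    j₁ = proj₂ (proj₂ (stored ab))
    j₂ : Joins e₂ b c
    j₂ = proj₂ (proj₂ (stored bc))
    j₃ : Joins e₃ a c
    j₃ = proj₂ (proj₂ (stored ac))

    parts-differ : ∀ {e : Fin n × Fin n} {x y : Fin n} → e ∈ E → Joins e x y → p x ≢ p y
    parts-differ e∈E (inj₁ refl) = proj₂ (in-K e∈E)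
    parts-differ e∈E (inj₂ refl) = proj₂ (in-K e∈E) ∘ sym

    pa≢pb : p a ≢ p b
    pa≢pb = parts-differ e₁∈E j₁
    pb≢pc : p b ≢ p c
    pb≢pc = parts-differ e₂∈E j₂
    pa≢pc : p a ≢ p c
    pa≢pc = parts-differ e₃∈E j₃

    -- The three triangle edges are distinct, as a, b, c lie in distinct parts.
    e₂≢e₁ : e₂ ≢ e₁
    e₂≢e₁ = joins-differ j₂ j₁ λ { (inj₁ (b≡a , _)) → pa≢pb (cong p (sym b≡a))
                                  ; (inj₂ (_ , c≡a)) → pa≢pc (cong p (sym c≡a)) }
    e₃≢e₁ : e₃ ≢ e₁
    e₃≢e₁ = joins-differ j₃ j₁ λ { (inj₁ (_ , c≡b)) → pb≢pc (cong p (sym c≡b))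
                                  ; (inj₂ (a≡b , _)) → pa≢pb (cong p a≡b) }
    e₃≢e₂ : e₃ ≢ e₂
    e₃≢e₂ = joins-differ j₃ j₂ λ { (inj₁ (a≡b , _)) → pa≢pb (cong p a≡b)
                                  ; (inj₂ (a≡c , _)) → pa≢pc (cong p a≡c) }

    front : Σ (List (Fin n × Fin n)) λ rest →
      length rest ≤ length E ∸ 3 × (∀ {e} → e ∈ E → e ∈ e₁ ∷ e₂ ∷ e₃ ∷ rest)
    front = Without.moveThreeToFront (Product.≡-dec Fin._≟_ Fin._≟_) e₁∈E e₂∈E e₃∈E e₂≢e₁ e₃≢e₁ e₃≢e₂

  rest : List (Fin n × Fin n)
  rest = proj₁ front

  rest-short : length rest ≤ length E ∸ 3
  rest-short = proj₁ (proj₂ front)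

  private
    D : List (Fin n × Fin n)
    D = e₁ ∷ e₂ ∷ e₃ ∷ rest

    covers : ∀ {e} → e ∈ E → e ∈ D
    covers = proj₂ (proj₂ front)

  code : List (Subgraph n) → List Bool
  code g = map (edgeBit g) D

  -- A garland has an edge, so its code has a true letter.
  code-nonzero : ∀ {g} → IsGarland p E g → Nonzero (code g)
  code-nonzero {[]} gar = ⊥-elim (proj₁ gar refl)
  code-nonzero {G ∷ g} gar with Garland.Member.some-edge p E gar (here refl)
  ... | x , y , Gxy with stored (Garland.linked-in-E p E gar (linked (here refl) Gxy))
  ... | e , e∈E , j = map⁺ (Any.map (λ e≡ → subst (T ∘ edgeBit (G ∷ g)) e≡ letter) (covers e∈E))
    where
    letter : T (edgeBit (G ∷ g) e)
    letter = Garland.joins⇒edgeBit p E gar j (linked (here refl) Gxy)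

  code-admissible : ∀ {g} → IsGarland p E g → code g ∈ admissible (length rest)
  code-admissible {g} gar = subst (λ k → code g ∈ admissible k) (length-map (edgeBit g) rest)
    (∈-admissible _ _ _ (map (edgeBit g) rest)
      (Garland.triangle-closed p E gar j₁ j₂ j₃ pa≢pb pb≢pc pa≢pc) (code-nonzero gar))

  -- Equal codes give equal union graphs, since D covers E ⊇ union graph.
  code-⊆ : ∀ {g h} → IsGarland p E g → IsGarland p E h → code g ≡ code h →
    ∀ {x y} → Linked g x y → Linked h x y
  code-⊆ gar-g gar-h same l with stored (Garland.linked-in-E p E gar-g l)
  ... | e , e∈E , j = Garland.edgeBit⇒joins p E gar-h j
    (subst T (map-≡-at D same (covers e∈E)) (Garland.joins⇒edgeBit p E gar-g j l))

  code-injective : ∀ {g h} → IsGarland p E g → IsGarland p E h → code g ≡ code h → SameSet g h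
  code-injective gar-g gar-h same =
    Reconstruction.union-determines p E gar-g gar-h (code-⊆ gar-g gar-h same) (code-⊆ gar-h gar-g (sym same))

lemma5 : (n t : ℕ) (p : Fin n → Fin t) → Surjective p →
    (E : List (Fin n × Fin n)) → IsEdgeSet p E → HasTriangle E →
    NumGarlandsAtMost p E (5 * 2 ^ (length E ∸ 3) ∸ 1)
lemma5 n t p _ E (_ , in-K) (_ , _ , _ , ab , bc , ac) L garlands distinct = begin
  length L
    ≤⟨ length-≤-by-injection (List.≡-dec Bool._≟_) code L (admissible (length rest)) distinct
         (λ g∈L h∈L g≉h same → g≉h (code-injective (garlands g∈L) (garlands h∈L) same))
         (λ g∈L → code-admissible (garlands g∈L)) ⟩
  length (admissible (length rest))
    ≤⟨ length-admissible (length rest) ⟩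
  5 * 2 ^ length rest ∸ 1
    ≤⟨ ∸-monoˡ-≤ 1 (*-monoʳ-≤ 5 (^-monoʳ-≤ 2 rest-short)) ⟩
  5 * 2 ^ (length E ∸ 3) ∸ 1 ∎
  where
  open Encoding p E in-K ab bc ac
  open ≤-Reasoning
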